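{- Consider an instance of set selection under uncertainty with intervals $\mathcal{I}=\{I_e\}_{e\in E}$, let $Q\subseteq E$ and let $w_e\in I_e$ for $e\in Q$ be arbitrary revealed values, giving the new instance with intervals $\mathcal{I}'=\{\{w_e\}\}_{e\in Q}\cup\{I_e\}_{e\in E\setminus Q}$ (same $E$ and $\mathcal{F}$). If $e\notin Q$ is blue (respectively red) with respect to $\mathcal{I}$, then $e$ is blue (respectively red) with respect to $\mathcal{I}'$.
   Context: An instance consists of a finite ground set $E$, a nonempty collection $\mathcal{F}\subseteq 2^E$ of feasible sets, and for each $e\in E$ an interval $I_e=[\ell_e,h_e]$, called trivial if $\ell_e=h_e$. For $e\in E$ and $w_{ -e}\in\mathbb{R}^{E\setminus\{e\}}$, let $\mathrm{OPT}^{ -e}(w_{ -e})=\min\{w(S)\mid S\in\mathcal{F},e\notin S\}$ and $\mathrm{OPT}^{+e}(w_{ -e})=\min\{w(S)\mid S\in\mathcal{F},e\in S\}$ with $w_e:=0$, where $w(S)=\sum_{f\in S}w_f$; the threshold is $T_e(w_{ -e})=\mathrm{OPT}^{ -e}-\mathrm{OPT}^{+e}$ ($+\infty$ if $e$ is in every feasible set, $-\infty$ if in none). With respect to a family of intervals, $T^+_e=\inf$ and $T^-_e=\sup$ of $T_e(w_{ -e})$ over all $w_{ -e}$ with $w_f$ in the interval of $f$ for all $f\neq e$. An element $e$ is blue if its interval $[\ell_e,h_e]$ is non-trivial and $h_e\le T^+_e$, and red if its interval is non-trivial and $T^-_e\le\ell_e$.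
   Formalization: The interval endpoints, the revealed values $w_e$ and the weights $w_{ -e}$ over which $T^+_e$ and $T^-_e$ are taken are rational rather than real. -}

module Defs where

open import Data.Nat using (ℕ; zero; suc)
open import Data.Fin using (Fin; zero; suc)
import Data.Bool
open import Data.Bool using (Bool; true; false; if_then_else_)
open import Data.Vec using (Vec; []; _∷_; lookup)
open import Data.List using (List; []; _∷_)
open import Relation.Nullary using (does)
import Data.Fin

_≡ᵇ_ : Bool → Bool → Bool
true  ≡ᵇ b = b
false ≡ᵇ b = Data.Bool.not b

open import Data.Maybe using (Maybe; just; nothing)
open import Data.Product using (_×_)
open import Data.Rational using (ℚ; 0ℚ; _+_; _-_; _≤_; _⊓_)
open import Relation.Binary.PropositionalEquality using (_≡_; _≢_)

-- Ground set E = Fin n; a subset of E is a Bool-vector (Data.Fin.Subset style).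
Subset : ℕ → Set
Subset n = Vec Bool n

record Instance : Set where
  field
    n        : ℕ
    feasible : List (Subset n)
    nonempty : feasible ≢ []

open Instance public

weight : ∀ {n} → (Fin n → ℚ) → Subset n → ℚ
weight {zero}  w []      = 0ℚ
weight {suc n} w (b ∷ S) = (if b then w zero else 0ℚ) + weight (λ i → w (suc i)) S

-- minimum of a finite list of rationals; nothing = minimum over the empty set
minM : ℚ → Maybe ℚ → Maybe ℚ
minM x nothing  = just x
minM x (just y) = just (x ⊓ y)

optWith : ∀ {n} → Bool → Fin n → (Fin n → ℚ) → List (Subset n) → Maybe ℚ
optWith b e w []       = nothing
optWith b e w (S ∷ 𝓕) =
  if (lookup S e ≡ᵇ b) then minM (weight w S) (optWith b e w 𝓕) else optWith b e w 𝓕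

zeroAt : ∀ {n} → Fin n → (Fin n → ℚ) → Fin n → ℚ
zeroAt e w f = if does (e Data.Fin.≟ f) then 0ℚ else w f

data ℚ∞ : Set where
  -∞  : ℚ∞
  fin : ℚ → ℚ∞
  +∞  : ℚ∞

data _≤∞_ : ℚ∞ → ℚ∞ → Set where
  -∞≤     : ∀ {x} → -∞ ≤∞ x
  ≤+∞     : ∀ {x} → x ≤∞ +∞
  fin≤fin : ∀ {p q} → p ≤ q → fin p ≤∞ fin q

-- OPT^{-e}(w_{-e}) and OPT^{+e}(w_{-e}) (with w_e := 0); nothing = no such feasible set
OPTminus OPTplus : (I : Instance) → Fin (n I) → (Fin (n I) → ℚ) → Maybe ℚ
OPTminus I e w = optWith false e (zeroAt e w) (feasible I)
OPTplus  I e w = optWith true  e (zeroAt e w) (feasible I)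

-- T_e(w_{-e}) = OPT^{-e} − OPT^{+e}; +∞ if e is in every feasible set, −∞ if in none.
-- (Only w_f for f ≠ e matter.)
threshold : (I : Instance) → Fin (n I) → (Fin (n I) → ℚ) → ℚ∞
threshold I e w with OPTminus I e w | OPTplus I e w
... | just a  | just b  = fin (a - b)
... | nothing | just _  = +∞
... | _       | nothing = -∞

record Intervals (k : ℕ) : Set where
  field
    lo hi : Fin k → ℚ

open Intervals public

InRangeExcept : ∀ {k} → Intervals k → Fin k → (Fin k → ℚ) → Set
InRangeExcept J e w = ∀ f → f ≢ e → (lo J f ≤ w f) × (w f ≤ hi J f)

-- h_e ≤ T⁺_e = inf_w T_e(w)   (unfolded: h_e is a lower bound of all T_e(w))
-- T⁻_e = sup_w T_e(w) ≤ ℓ_e   (unfolded: ℓ_e is an upper bound of all T_e(w))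
Blue : (I : Instance) → Intervals (n I) → Fin (n I) → Set
Blue I J e = (lo J e ≢ hi J e) ×
  (∀ w → InRangeExcept J e w → fin (hi J e) ≤∞ threshold I e w)

Red : (I : Instance) → Intervals (n I) → Fin (n I) → Set
Red I J e = (lo J e ≢ hi J e) ×
  (∀ w → InRangeExcept J e w → threshold I e w ≤∞ fin (lo J e))

reveal : ∀ {k} → Intervals k → Subset k → (Fin k → ℚ) → Intervals k
lo (reveal J Q v) f = if lookup Q f then v f else lo J f
hi (reveal J Q v) f = if lookup Q f then v f else hi J f

ValidIntervals : ∀ {k} → Intervals k → Set
ValidIntervals J = ∀ f → lo J f ≤ hi J f

-- Revealing values only shrinks the intervals of the revealed elements, so it shrinks the set of
-- admissible w₋ₑ.  Blueness (redness) of e says h_e (ℓ_e) bounds the threshold on that set from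
-- below (above); such bounds survive passing to a subset, and the interval of e ∉ Q is unchanged.
module Submission where

open import Defs
open import Data.Fin using (Fin)
open import Data.Bool using (true; false)
open import Data.Vec using (lookup)
open import Data.Product using (_×_; _,_)
open import Data.Rational using (ℚ; _≤_)
open import Data.Rational.Properties using (≤-refl; ≤-trans)
open import Relation.Binary.PropositionalEquality using (_≡_; _≢_; refl; sym; subst; subst₂)

_⊑_ : ∀ {k} → Intervals k → Intervals k → Set
J′ ⊑ J = ∀ f → (lo J f ≤ lo J′ f) × (hi J′ f ≤ hi J f)

InRangeExcept-mono : ∀ {k} {J′ J : Intervals k} → J′ ⊑ J →
                     ∀ e w → InRangeExcept J′ e w → InRangeExcept J e w
InRangeExcept-mono J′⊑J e w r f f≢e with J′⊑J f | r f f≢e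
... | lo≤lo′ , hi′≤hi | lo′≤w , w≤hi′ = ≤-trans lo≤lo′ lo′≤w , ≤-trans w≤hi′ hi′≤hi

SameIntervalAt : ∀ {k} → Intervals k → Intervals k → Fin k → Set
SameIntervalAt J′ J e = (lo J′ e ≡ lo J e) × (hi J′ e ≡ hi J e)

Blue-mono : ∀ I {J′ J : Intervals (n I)} e → J′ ⊑ J → SameIntervalAt J′ J e →
            Blue I J e → Blue I J′ e
Blue-mono I e J′⊑J (lo′≡lo , hi′≡hi) (nontrivial , below) =
  subst₂ _≢_ (sym lo′≡lo) (sym hi′≡hi) nontrivial ,
  λ w r → subst (λ h → fin h ≤∞ threshold I e w) (sym hi′≡hi)
                (below w (InRangeExcept-mono J′⊑J e w r))

Red-mono : ∀ I {J′ J : Intervals (n I)} e → J′ ⊑ J → SameIntervalAt J′ J e →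
           Red I J e → Red I J′ e
Red-mono I e J′⊑J (lo′≡lo , hi′≡hi) (nontrivial , above) =
  subst₂ _≢_ (sym lo′≡lo) (sym hi′≡hi) nontrivial ,
  λ w r → subst (λ ℓ → threshold I e w ≤∞ fin ℓ) (sym lo′≡lo)
                (above w (InRangeExcept-mono J′⊑J e w r))

reveal-⊑ : ∀ {k} (J : Intervals k) Q v →
           (∀ f → lookup Q f ≡ true → (lo J f ≤ v f) × (v f ≤ hi J f)) →
           reveal J Q v ⊑ J
reveal-⊑ J Q v v∈J f with lookup Q f in Qf
... | true  = v∈J f Qf
... | false = ≤-refl , ≤-refl

reveal-unrevealed : ∀ {k} (J : Intervals k) Q v {e} → lookup Q e ≡ false →
                    SameIntervalAt (reveal J Q v) J e
reveal-unrevealed J Q v e∉Q rewrite e∉Q = refl , refl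

lemma3p2 : (I : Instance) (J : Intervals (n I)) → ValidIntervals J →
           (Q : Subset (n I)) (v : Fin (n I) → ℚ) →
           (∀ f → lookup Q f ≡ true → (lo J f ≤ v f) × (v f ≤ hi J f)) →
           (e : Fin (n I)) → lookup Q e ≡ false →
           (Blue I J e → Blue I (reveal J Q v) e) × (Red I J e → Red I (reveal J Q v) e)
lemma3p2 I J _ Q v v∈J e e∉Q =
  Blue-mono I e (reveal-⊑ J Q v v∈J) (reveal-unrevealed J Q v e∉Q) ,
  Red-mono I e (reveal-⊑ J Q v v∈J) (reveal-unrevealed J Q v e∉Q)
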